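{- Let $G=(\mathcal{F}\cup\mathcal{C},E)$ be a bipartite graph between a finite set $\mathcal{F}$ of facilities and a finite set $\mathcal{C}$ of clients, and let $g:\mathcal{C}\to\mathcal{C}$ be the random clustering obtained from $G$ by the randomized clustering procedure described in the context. Then for every two distinct clients $j,j'\in\mathcal{C}$, \[ \Pr[g(j)=j']=\Pr[g(j')=j]. \]
   Context: Two clients are neighbors in $G$ if they are adjacent to a common facility. Randomized clustering procedure: while some client is unclustered, choose a cluster center uniformly at random among the currently unclustered clients, and form a new cluster consisting of this center together with all of its neighbors that are not yet clustered. For each client $j$, $g(j)$ denotes the center of the cluster containing $j$ (so $g(j)=j$ for a center). -}

module Defs where

open import Data.Bool using (Bool; true; false; _∧_; if_then_else_)
open import Data.Nat using (ℕ; zero; suc)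
open import Data.Fin using (Fin; _≟_)
open import Data.Fin.Subset using (Subset; ⁅_⁆; _∪_; _∩_; _─_; ∣_∣; ⊤)
open import Data.Vec using (lookup; tabulate)
open import Data.List using (List; []; _∷_; map; concatMap; allFin; filterᵇ; foldr)
open import Data.Bool.ListAction using (any)
open import Data.Product using (_×_; _,_; proj₁; proj₂)
open import Data.Integer using (+_)
open import Data.Rational using (ℚ; _/_; _*_; _+_; 0ℚ; 1ℚ)
open import Relation.Nullary using (does)

BipGraph : ℕ → ℕ → Set
BipGraph m n = Fin m → Fin n → Bool

neighbors? : ∀ {m n} → BipGraph m n → Fin n → Fin n → Bool
neighbors? {m} E j j' = any (λ f → E f j ∧ E f j') (allFin m)

cluster : ∀ {m n} → BipGraph m n → Subset n → Fin n → Subset n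
cluster E U c = ⁅ c ⁆ ∪ (U ∩ tabulate (neighbors? E c))

Dist : Set → Set
Dist A = List (ℚ × A)

-- uniform weight 1/k (k = 0 never occurs where it is used)
unif : ℕ → ℚ
unif zero    = 0ℚ
unif (suc k) = (+ 1) / suc k

-- run k U : distribution of the assignment g (client ↦ its cluster center),
-- obtained by running the procedure from the state with unclustered set U.
-- Only the values of g on U are produced by this run.  The fuel k decreases
-- with every round; since each round clusters at least its center,
-- fuel n (= number of clients) is always sufficient when starting from U = ⊤.
run : ∀ {m n} → BipGraph m n → ℕ → Subset n → Dist (Fin n → Fin n)
run E zero    U = (1ℚ , (λ x → x)) ∷ []
run {n = n} E (suc k) U with ∣ U ∣
... | zero  = (1ℚ , (λ x → x)) ∷ []
... | suc r =
  concatMap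
    (λ c → let C = cluster E U c in
      map (λ { (p , h) → (unif (suc r) * p ,
                           (λ x → if lookup C x then c else h x)) })
          (run E k (U ─ C)))
    (filterᵇ (lookup U) (allFin n))

clustering : ∀ {m n} → BipGraph m n → Dist (Fin n → Fin n)
clustering {n = n} E = run E n ⊤

Pr : ∀ {A : Set} → Dist A → (A → Bool) → ℚ
Pr D ev = foldr (λ { (p , a) acc → (if ev a then p else 0ℚ) + acc }) 0ℚ D

PrCenter : ∀ {m n} → BipGraph m n → Fin n → Fin n → ℚ
PrCenter E j j' = Pr (clustering E) (λ g → does (g j ≟ j'))

-- Run the procedure from any set U of unclustered clients and condition on the
-- first centre c, which is uniform on U.  Then g(j) = j' either because c = j'
-- and j is an unclustered neighbour of j', which has probability
-- [j, j' ∈ U and j ~ j'] / |U| and is symmetric in j and j', or because the run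
-- from U minus the first cluster sends j to j'.  A client outside the
-- unclustered set is never reassigned, so the second term needs no survival
-- condition: it is the average over c of the same probability for the shorter
-- runs, which is symmetric by induction on the number of rounds.
module Submission where

open import Defs

open import Algebra.Bundles using (CommutativeRing)
open import Data.Bool using (Bool; true; false; not; _∧_; _∨_; if_then_else_)
open import Data.Bool.ListAction using (or)
open import Data.Bool.Properties using (∧-comm; ∧-zeroʳ; ∧-identityʳ)
open import Data.Fin using (Fin; zero; suc; _≟_; punchIn)
open import Data.Fin.Properties using (punchInᵢ≢i)
open import Data.Fin.Subset using (Subset; ⁅_⁆; ∣_∣; _─_; ⊤)
import Data.Integer as ℤ
import Data.Integer.Properties as ℤ
open import Data.List using (List; []; _∷_; _++_; map; concatMap; filterᵇ; foldr; allFin; tabulate)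
open import Data.List.Properties using (map-cong)
open import Data.Nat using (ℕ; zero; suc)
open import Data.Product using (_×_; _,_; ∃-syntax)
open import Data.Sum using (_⊎_; inj₁; inj₂)
open import Data.Rational using (ℚ; _+_; _*_; 0ℚ; 1ℚ; toℚᵘ; +-0-rawMonoid)
open import Data.Rational.Properties
  using (+-assoc; +-identityˡ; +-identityʳ; *-zeroʳ; *-identityʳ; *-distribˡ-+;
         +-*-commutativeRing; toℚᵘ-homo-+; toℚᵘ-injective; toℚᵘ-fromℚᵘ)
open import Data.Rational.Unnormalised as ℚᵘ using (ℚᵘ; mkℚᵘ; *≡*; 1ℚᵘ)
import Data.Rational.Unnormalised.Properties as ℚᵘ
open import Data.Vec using ([]; _∷_; lookup)
open import Data.Vec.Properties using (lookup-zipWith; lookup∘tabulate; lookup-replicate)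
open import Function using (_∘_; id)
open import Relation.Binary.PropositionalEquality
  using (_≡_; _≢_; _≗_; refl; sym; trans; cong; cong₂; module ≡-Reasoning)
open import Relation.Nullary.Decidable using (Dec; does; yes; no; dec-true; dec-false)

open import Algebra.Definitions.RawMonoid +-0-rawMonoid using () renaming (_×_ to _·_)
open import Algebra.Properties.Semiring.Sum (CommutativeRing.semiring +-*-commutativeRing)
  using (sum; sum-syntax; ∑-distrib-+; sum-cong-≗; sum-remove; sum-replicate-zero)

-- ℚ normalises by gcd, which does not compute on a variable numerator, so the
-- identity (1 + r) · 1/(1 + r) = 1 is checked in ℚᵘ.
fromℕᵘ : ℕ → ℚᵘ
fromℕᵘ k = mkℚᵘ (ℤ.+ k) 0

fromℕᵘ-suc : ∀ k → 1ℚᵘ ℚᵘ.+ fromℕᵘ k ℚᵘ.≃ fromℕᵘ (suc k)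
fromℕᵘ-suc k = *≡* (begin
  (ℤ.+ 1 ℤ.* ℤ.+ 1 ℤ.+ ℤ.+ k ℤ.* ℤ.+ 1) ℤ.* ℤ.+ 1  ≡⟨ ℤ.*-identityʳ _ ⟩
  ℤ.+ 1 ℤ.+ ℤ.+ k ℤ.* ℤ.+ 1                      ≡⟨ cong (ℤ._+_ ℤ.1ℤ) (ℤ.*-identityʳ (ℤ.+ k)) ⟩
  ℤ.+ suc k                                      ≡⟨ ℤ.*-identityʳ (ℤ.+ suc k) ⟨
  ℤ.+ suc k ℤ.* ℤ.+ 1                            ∎)
  where open ≡-Reasoning

toℚᵘ-· : ∀ k w → toℚᵘ (k · w) ℚᵘ.≃ fromℕᵘ k ℚᵘ.* toℚᵘ w
toℚᵘ-· zero    w = ℚᵘ.≃-sym (ℚᵘ.*-zeroˡ (toℚᵘ w))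
toℚᵘ-· (suc k) w = begin
  toℚᵘ (w + k · w)                               ≈⟨ toℚᵘ-homo-+ w (k · w) ⟩
  toℚᵘ w ℚᵘ.+ toℚᵘ (k · w)                       ≈⟨ ℚᵘ.+-congʳ (toℚᵘ w) (toℚᵘ-· k w) ⟩
  toℚᵘ w ℚᵘ.+ fromℕᵘ k ℚᵘ.* toℚᵘ w               ≈⟨ ℚᵘ.+-congˡ _ (ℚᵘ.*-identityˡ (toℚᵘ w)) ⟨
  1ℚᵘ ℚᵘ.* toℚᵘ w ℚᵘ.+ fromℕᵘ k ℚᵘ.* toℚᵘ w      ≈⟨ ℚᵘ.*-distribʳ-+ (toℚᵘ w) 1ℚᵘ (fromℕᵘ k) ⟨
  (1ℚᵘ ℚᵘ.+ fromℕᵘ k) ℚᵘ.* toℚᵘ w                ≈⟨ ℚᵘ.*-congʳ {toℚᵘ w} (fromℕᵘ-suc k) ⟩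
  fromℕᵘ (suc k) ℚᵘ.* toℚᵘ w                     ∎
  where open import Relation.Binary.Reasoning.Setoid ℚᵘ.≃-setoid

·-unif : ∀ r → suc r · unif (suc r) ≡ 1ℚ
·-unif r = toℚᵘ-injective (begin
  toℚᵘ (suc r · unif (suc r))                       ≈⟨ toℚᵘ-· (suc r) (unif (suc r)) ⟩
  fromℕᵘ (suc r) ℚᵘ.* toℚᵘ (unif (suc r))           ≈⟨ ℚᵘ.*-congˡ {fromℕᵘ (suc r)} (toℚᵘ-fromℚᵘ (mkℚᵘ (ℤ.+ 1) r)) ⟩
  fromℕᵘ (suc r) ℚᵘ.* ℚᵘ.1/ fromℕᵘ (suc r)          ≈⟨ ℚᵘ.*-inverseʳ (fromℕᵘ (suc r)) ⟩
  1ℚᵘ                                               ∎)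
  where open import Relation.Binary.Reasoning.Setoid ℚᵘ.≃-setoid

open ≡-Reasoning

when : Bool → ℚ → ℚ
when b x = if b then x else 0ℚ

when-+ : ∀ b x y → when b (x + y) ≡ when b x + when b y
when-+ true  x y = refl
when-+ false x y = sym (+-identityˡ 0ℚ)

when-* : ∀ b w x → when b (w * x) ≡ w * when b x
when-* true  w x = refl
when-* false w x = sym (*-zeroʳ w)

when-0 : ∀ b → when b 0ℚ ≡ 0ℚ
when-0 true  = refl
when-0 false = refl

when-∧-swap : ∀ a b x w → when a (w * when (b ∧ x) 1ℚ) ≡ when b (w * when (a ∧ x) 1ℚ)
when-∧-swap true  true  x w = refl
when-∧-swap true  false x w = *-zeroʳ w
when-∧-swap false true  x w = sym (*-zeroʳ w)
when-∧-swap false false x w = refl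

sumℚ : List ℚ → ℚ
sumℚ = foldr _+_ 0ℚ

sumℚ-filterᵇ-tabulate : ∀ {A : Set} {n} (P : A → Bool) (f : A → ℚ) (g : Fin n → A) →
  sumℚ (map f (filterᵇ P (tabulate g))) ≡ ∑[ i < n ] when (P (g i)) (f (g i))
sumℚ-filterᵇ-tabulate {n = zero}  P f g = refl
sumℚ-filterᵇ-tabulate {n = suc n} P f g with P (g zero)
... | true  = cong (f (g zero) +_) (sumℚ-filterᵇ-tabulate P f (g ∘ suc))
... | false = trans (sumℚ-filterᵇ-tabulate P f (g ∘ suc)) (sym (+-identityˡ _))

∑-single : ∀ {n} (f : Fin n → ℚ) (i : Fin n) → (∀ k → k ≢ i → f k ≡ 0ℚ) →
  ∑[ k < n ] f k ≡ f i
∑-single {suc n} f i f≡0 = begin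
  sum f                                     ≡⟨ sum-remove {i = i} f ⟩
  f i + ∑[ k < n ] f (punchIn i k)          ≡⟨ cong (f i +_) (sum-cong-≗ (λ k → f≡0 _ (punchInᵢ≢i i k))) ⟩
  f i + ∑[ k < n ] 0ℚ                       ≡⟨ cong (f i +_) (sum-replicate-zero n) ⟩
  f i + 0ℚ                                  ≡⟨ +-identityʳ (f i) ⟩
  f i                                       ∎

∑-indicator : ∀ {n} (U : Subset n) (w : ℚ) → ∑[ c < n ] when (lookup U c) w ≡ ∣ U ∣ · w
∑-indicator []          w = refl
∑-indicator (true ∷ U)  w = cong (w +_) (∑-indicator U w)
∑-indicator (false ∷ U) w = trans (+-identityˡ _) (∑-indicator U w)

module _ {A : Set} where

  Pr-++ : (D D′ : Dist A) (ev : A → Bool) → Pr (D ++ D′) ev ≡ Pr D ev + Pr D′ ev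
  Pr-++ []            D′ ev = sym (+-identityˡ _)
  Pr-++ ((p , a) ∷ D) D′ ev =
    trans (cong (when (ev a) p +_) (Pr-++ D D′ ev)) (sym (+-assoc (when (ev a) p) _ _))

  Pr-cong : (D : Dist A) {ev ev′ : A → Bool} → ev ≗ ev′ → Pr D ev ≡ Pr D ev′
  Pr-cong []            ev≗ev′ = refl
  Pr-cong ((p , a) ∷ D) ev≗ev′ = cong₂ _+_ (cong (λ b → when b p) (ev≗ev′ a)) (Pr-cong D ev≗ev′)

  Pr-never : (D : Dist A) → Pr D (λ _ → false) ≡ 0ℚ
  Pr-never []            = refl
  Pr-never ((p , a) ∷ D) = trans (+-identityˡ _) (Pr-never D)

Pr-concatMap : ∀ {A B : Set} (f : A → Dist B) (xs : List A) (ev : B → Bool) →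
  Pr (concatMap f xs) ev ≡ sumℚ (map (λ a → Pr (f a) ev) xs)
Pr-concatMap f []       ev = refl
Pr-concatMap f (x ∷ xs) ev =
  trans (Pr-++ (f x) (concatMap f xs) ev) (cong (Pr (f x) ev +_) (Pr-concatMap f xs ev))

-- φ is specified by an equation because `run` maps a pattern-matching lambda.
Pr-map-scaled : ∀ {A B : Set} (φ : ℚ × A → ℚ × B) (w : ℚ) (ψ : A → B) →
  (∀ p a → φ (p , a) ≡ (w * p , ψ a)) →
  (D : Dist A) (ev : B → Bool) → Pr (map φ D) ev ≡ w * Pr D (ev ∘ ψ)
Pr-map-scaled φ w ψ φ≡ []            ev = sym (*-zeroʳ w)
Pr-map-scaled φ w ψ φ≡ ((p , a) ∷ D) ev rewrite φ≡ p a = begin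
  when (ev (ψ a)) (w * p) + Pr (map φ D) ev  ≡⟨ cong₂ _+_ (when-* (ev (ψ a)) w p) (Pr-map-scaled φ w ψ φ≡ D ev) ⟩
  w * when (ev (ψ a)) p + w * Pr D (ev ∘ ψ)  ≡⟨ *-distribˡ-+ w _ _ ⟨
  w * Pr ((p , a) ∷ D) (ev ∘ ψ)              ∎

zero-or-suc : ∀ k → k ≡ 0 ⊎ ∃[ r ] k ≡ suc r
zero-or-suc zero    = inj₁ refl
zero-or-suc (suc r) = inj₂ (r , refl)

lookup-⁅⁆ : ∀ {n} (c x : Fin n) → lookup ⁅ c ⁆ x ≡ does (c ≟ x)
lookup-⁅⁆ zero    zero    = refl
lookup-⁅⁆ zero    (suc x) = lookup-replicate x false
lookup-⁅⁆ (suc c) zero    = refl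
lookup-⁅⁆ (suc c) (suc x) = lookup-⁅⁆ c x

lookup-─ : ∀ {n} (U V : Subset n) (x : Fin n) → lookup (U ─ V) x ≡ lookup U x ∧ not (lookup V x)
lookup-─ (u ∷ U) (true ∷ V)  zero    = sym (∧-zeroʳ u)
lookup-─ (u ∷ U) (false ∷ V) zero    = sym (∧-identityʳ u)
lookup-─ (u ∷ U) (v ∷ V)     (suc x) = lookup-─ U V x

module _ {m n : ℕ} (E : BipGraph m n) where

  neighbors?-sym : (c x : Fin n) → neighbors? E c x ≡ neighbors? E x c
  neighbors?-sym c x = cong or (map-cong (λ f → ∧-comm (E f c) (E f x)) (allFin m))

  lookup-cluster : (U : Subset n) (c x : Fin n) →
    lookup (cluster E U c) x ≡ does (c ≟ x) ∨ (lookup U x ∧ neighbors? E c x)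
  lookup-cluster U c x = trans (lookup-zipWith _∨_ x ⁅ c ⁆ _)
    (cong₂ _∨_ (lookup-⁅⁆ c x)
      (trans (lookup-zipWith _∧_ x U _) (cong (lookup U x ∧_) (lookup∘tabulate (neighbors? E c) x))))

  lookup-cluster-≢ : (U : Subset n) {c x : Fin n} → c ≢ x →
    lookup (cluster E U c) x ≡ lookup U x ∧ neighbors? E c x
  lookup-cluster-≢ U {c} {x} c≢x =
    trans (lookup-cluster U c x) (cong (_∨ (lookup U x ∧ neighbors? E c x)) (dec-false (c ≟ x) c≢x))

  remaining : Subset n → Fin n → Subset n
  remaining U c = U ─ cluster E U c

  remaining-unclustered : ∀ U c {x} → lookup U x ≡ false → lookup (remaining U c) x ≡ false
  remaining-unclustered U c {x} Ux =
    trans (lookup-─ U (cluster E U c) x) (cong (_∧ not (lookup (cluster E U c) x)) Ux)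

  remaining-clustered : ∀ U c {x} → lookup (cluster E U c) x ≡ true → lookup (remaining U c) x ≡ false
  remaining-clustered U c {x} x∈C =
    trans (lookup-─ U (cluster E U c) x) (trans (cong (λ b → lookup U x ∧ not b) x∈C) (∧-zeroʳ (lookup U x)))

  assign : Subset n → Fin n → (Fin n → Fin n) → Fin n → Fin n
  assign U c h x = if lookup (cluster E U c) x then c else h x

  assign-unclustered : (U : Subset n) {c x : Fin n} (h : Fin n → Fin n) →
    lookup U c ≡ true → lookup U x ≡ false → assign U c h x ≡ h x
  assign-unclustered U {c} {x} h Uc Ux =
    cong (λ b → if b then c else h x) (trans (lookup-cluster-≢ U c≢x) (cong (_∧ neighbors? E c x) Ux))
    where
    c≢x : c ≢ x
    c≢x refl with () ← trans (sym Uc) Ux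

  Pr-run-exhausted : ∀ k U → ∣ U ∣ ≡ 0 → (ev : (Fin n → Fin n) → Bool) →
    Pr (run E (suc k) U) ev ≡ Pr (run E 0 U) ev
  Pr-run-exhausted k U ∣U∣≡0 ev with ∣ U ∣ | ∣U∣≡0
  ... | _ | refl = refl

  Pr-run-step : ∀ k U {r} → ∣ U ∣ ≡ suc r → (ev : (Fin n → Fin n) → Bool) →
    Pr (run E (suc k) U) ev ≡
    ∑[ c < n ] when (lookup U c) (unif (suc r) * Pr (run E k (remaining U c)) (ev ∘ assign U c))
  Pr-run-step k U {r} ∣U∣≡ ev with ∣ U ∣ | ∣U∣≡
  ... | _ | refl = begin
    Pr (concatMap (λ c → map (scaled c) (next c)) unclustered) ev
      ≡⟨ Pr-concatMap _ unclustered ev ⟩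
    sumℚ (map (λ c → Pr (map (scaled c) (next c)) ev) unclustered)
      ≡⟨ cong sumℚ (map-cong (λ c → Pr-map-scaled (scaled c) w (assign U c) (λ _ _ → refl) (next c) ev) unclustered) ⟩
    sumℚ (map (λ c → w * Pr (next c) (ev ∘ assign U c)) unclustered)
      ≡⟨ sumℚ-filterᵇ-tabulate (lookup U) _ id ⟩
    ∑[ c < n ] when (lookup U c) (w * Pr (next c) (ev ∘ assign U c))
      ∎
    where
    w = unif (suc r)
    unclustered = filterᵇ (lookup U) (allFin n)
    next : Fin n → Dist (Fin n → Fin n)
    next c = run E k (remaining U c)
    scaled : Fin n → ℚ × (Fin n → Fin n) → ℚ × (Fin n → Fin n)
    scaled c (p , h) = (w * p , assign U c h)

  Pr-run-total : ∀ k U → Pr (run E k U) (λ _ → true) ≡ 1ℚ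
  Pr-run-total zero    U = +-identityʳ 1ℚ
  Pr-run-total (suc k) U with zero-or-suc ∣ U ∣
  ... | inj₁ ∣U∣≡0       = trans (Pr-run-exhausted k U ∣U∣≡0 (λ _ → true)) (+-identityʳ 1ℚ)
  ... | inj₂ (r , ∣U∣≡) = begin
    Pr (run E (suc k) U) (λ _ → true)             ≡⟨ Pr-run-step k U ∣U∣≡ (λ _ → true) ⟩
    ∑[ c < n ] when (lookup U c) (w * Pr (run E k (remaining U c)) (λ _ → true))
      ≡⟨ sum-cong-≗ (λ c → cong (when (lookup U c)) (trans (cong (w *_) (Pr-run-total k (remaining U c))) (*-identityʳ w))) ⟩
    ∑[ c < n ] when (lookup U c) w                ≡⟨ ∑-indicator U w ⟩
    ∣ U ∣ · w                                     ≡⟨ cong (_· w) ∣U∣≡ ⟩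
    suc r · w                                     ≡⟨ ·-unif r ⟩
    1ℚ                                            ∎
    where w = unif (suc r)

  centerIs : Fin n → Fin n → (Fin n → Fin n) → Bool
  centerIs j j′ g = does (g j ≟ j′)

  Pr-run₀-centerIs : ∀ U {j j′} → j ≢ j′ → Pr (run E 0 U) (centerIs j j′) ≡ 0ℚ
  Pr-run₀-centerIs U {j} {j′} j≢j′ = cong (λ b → when b 1ℚ + 0ℚ) (dec-false (j ≟ j′) j≢j′)

  Pr-run-unclustered : ∀ k U {j j′} → j ≢ j′ → lookup U j ≡ false →
    Pr (run E k U) (centerIs j j′) ≡ 0ℚ
  Pr-run-unclustered zero    U j≢j′ Uj = Pr-run₀-centerIs U j≢j′
  Pr-run-unclustered (suc k) U {j} {j′} j≢j′ Uj with zero-or-suc ∣ U ∣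
  ... | inj₁ ∣U∣≡0       = trans (Pr-run-exhausted k U ∣U∣≡0 (centerIs j j′)) (Pr-run₀-centerIs U j≢j′)
  ... | inj₂ (r , ∣U∣≡) = begin
    Pr (run E (suc k) U) (centerIs j j′)  ≡⟨ Pr-run-step k U ∣U∣≡ (centerIs j j′) ⟩
    ∑[ c < n ] term c                     ≡⟨ sum-cong-≗ term≡0 ⟩
    ∑[ c < n ] 0ℚ                         ≡⟨ sum-replicate-zero n ⟩
    0ℚ                                    ∎
    where
    w = unif (suc r)
    term : Fin n → ℚ
    term c = when (lookup U c) (w * Pr (run E k (remaining U c)) (centerIs j j′ ∘ assign U c))
    term≡0 : ∀ c → term c ≡ 0ℚ
    term≡0 c with lookup U c in Uc
    ... | false = refl
    ... | true  = begin
      w * Pr (run E k (remaining U c)) (centerIs j j′ ∘ assign U c)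
        ≡⟨ cong (w *_) (Pr-cong (run E k (remaining U c)) (λ h → cong (λ x → does (x ≟ j′)) (assign-unclustered U h Uc Uj))) ⟩
      w * Pr (run E k (remaining U c)) (centerIs j j′)
        ≡⟨ cong (w *_) (Pr-run-unclustered k (remaining U c) j≢j′ (remaining-unclustered U c Uj)) ⟩
      w * 0ℚ
        ≡⟨ *-zeroʳ w ⟩
      0ℚ ∎

  Pr-run-assign : ∀ k U c {j j′} → j ≢ j′ →
    Pr (run E k (remaining U c)) (centerIs j j′ ∘ assign U c) ≡
    when (lookup (cluster E U c) j ∧ does (c ≟ j′)) 1ℚ + Pr (run E k (remaining U c)) (centerIs j j′)
  Pr-run-assign k U c {j} {j′} j≢j′ with lookup (cluster E U c) j in j∈C
  ... | false = sym (+-identityˡ _)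
  ... | true  = begin
    Pr D (λ _ → does (c ≟ j′))         ≡⟨ Pr-const (c ≟ j′) ⟩
    when (does (c ≟ j′)) 1ℚ            ≡⟨ +-identityʳ _ ⟨
    when (does (c ≟ j′)) 1ℚ + 0ℚ       ≡⟨ cong (when (does (c ≟ j′)) 1ℚ +_) (Pr-run-unclustered k (remaining U c) j≢j′ (remaining-clustered U c j∈C)) ⟨
    when (does (c ≟ j′)) 1ℚ + Pr D (centerIs j j′) ∎
    where
    D = run E k (remaining U c)
    Pr-const : ∀ {P : Set} (d : Dec P) → Pr D (λ _ → does d) ≡ when (does d) 1ℚ
    Pr-const (yes _) = Pr-run-total k (remaining U c)
    Pr-const (no _)  = Pr-never D

  firstRound : Subset n → ℚ → Fin n → Fin n → ℚ
  firstRound U w j j′ = ∑[ c < n ] when (lookup U c) (w * when (lookup (cluster E U c) j ∧ does (c ≟ j′)) 1ℚ)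

  firstRound-value : ∀ U w {j j′} → j ≢ j′ →
    firstRound U w j j′ ≡ when (lookup U j′) (w * when (lookup U j ∧ neighbors? E j′ j) 1ℚ)
  firstRound-value U w {j} {j′} j≢j′ = trans (∑-single term j′ term≡0) term-j′
    where
    term : Fin n → ℚ
    term c = when (lookup U c) (w * when (lookup (cluster E U c) j ∧ does (c ≟ j′)) 1ℚ)
    term≡0 : ∀ c → c ≢ j′ → term c ≡ 0ℚ
    term≡0 c c≢j′ rewrite dec-false (c ≟ j′) c≢j′ | ∧-zeroʳ (lookup (cluster E U c) j) =
      trans (cong (when (lookup U c)) (*-zeroʳ w)) (when-0 (lookup U c))
    term-j′ : term j′ ≡ when (lookup U j′) (w * when (lookup U j ∧ neighbors? E j′ j) 1ℚ)
    term-j′ rewrite dec-true (j′ ≟ j′) refl | ∧-identityʳ (lookup (cluster E U j′) j)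
                  | lookup-cluster-≢ U (j≢j′ ∘ sym) = refl

  firstRound-sym : ∀ U w {j j′} → j ≢ j′ → firstRound U w j j′ ≡ firstRound U w j′ j
  firstRound-sym U w {j} {j′} j≢j′ = begin
    firstRound U w j j′                                                 ≡⟨ firstRound-value U w j≢j′ ⟩
    when (lookup U j′) (w * when (lookup U j ∧ neighbors? E j′ j) 1ℚ)  ≡⟨ when-∧-swap (lookup U j′) (lookup U j) _ w ⟩
    when (lookup U j) (w * when (lookup U j′ ∧ neighbors? E j′ j) 1ℚ)  ≡⟨ cong (λ b → when (lookup U j) (w * when (lookup U j′ ∧ b) 1ℚ)) (neighbors?-sym j′ j) ⟩
    when (lookup U j) (w * when (lookup U j′ ∧ neighbors? E j j′) 1ℚ)  ≡⟨ firstRound-value U w (j≢j′ ∘ sym) ⟨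
    firstRound U w j′ j                                                 ∎

  Pr-run-step-centerIs : ∀ k U {r} → ∣ U ∣ ≡ suc r → ∀ {j j′} → j ≢ j′ →
    Pr (run E (suc k) U) (centerIs j j′) ≡
    firstRound U (unif (suc r)) j j′ +
    ∑[ c < n ] when (lookup U c) (unif (suc r) * Pr (run E k (remaining U c)) (centerIs j j′))
  Pr-run-step-centerIs k U {r} ∣U∣≡ {j} {j′} j≢j′ = begin
    Pr (run E (suc k) U) (centerIs j j′)
      ≡⟨ Pr-run-step k U ∣U∣≡ (centerIs j j′) ⟩
    ∑[ c < n ] when (lookup U c) (w * Pr (run E k (remaining U c)) (centerIs j j′ ∘ assign U c))
      ≡⟨ sum-cong-≗ term-split ⟩
    ∑[ c < n ] (firstTerm c + laterTerm c)
      ≡⟨ ∑-distrib-+ firstTerm laterTerm ⟩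
    firstRound U w j j′ + ∑[ c < n ] laterTerm c
      ∎
    where
    w = unif (suc r)
    firstTerm laterTerm : Fin n → ℚ
    firstTerm c = when (lookup U c) (w * when (lookup (cluster E U c) j ∧ does (c ≟ j′)) 1ℚ)
    laterTerm c = when (lookup U c) (w * Pr (run E k (remaining U c)) (centerIs j j′))
    term-split : ∀ c → when (lookup U c) (w * Pr (run E k (remaining U c)) (centerIs j j′ ∘ assign U c))
                       ≡ firstTerm c + laterTerm c
    term-split c = trans (cong (λ z → when (lookup U c) (w * z)) (Pr-run-assign k U c j≢j′))
                         (trans (cong (when (lookup U c)) (*-distribˡ-+ w _ _)) (when-+ (lookup U c) _ _))

  Pr-run-symmetric : ∀ k U {j j′} → j ≢ j′ →
    Pr (run E k U) (centerIs j j′) ≡ Pr (run E k U) (centerIs j′ j)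
  Pr-run-symmetric zero U j≢j′ =
    trans (Pr-run₀-centerIs U j≢j′) (sym (Pr-run₀-centerIs U (j≢j′ ∘ sym)))
  Pr-run-symmetric (suc k) U {j} {j′} j≢j′ with zero-or-suc ∣ U ∣
  ... | inj₁ ∣U∣≡0 = begin
    Pr (run E (suc k) U) (centerIs j j′)  ≡⟨ Pr-run-exhausted k U ∣U∣≡0 (centerIs j j′) ⟩
    Pr (run E 0 U) (centerIs j j′)        ≡⟨ Pr-run-symmetric 0 U j≢j′ ⟩
    Pr (run E 0 U) (centerIs j′ j)        ≡⟨ Pr-run-exhausted k U ∣U∣≡0 (centerIs j′ j) ⟨
    Pr (run E (suc k) U) (centerIs j′ j)  ∎
  ... | inj₂ (r , ∣U∣≡) = begin
    Pr (run E (suc k) U) (centerIs j j′)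
      ≡⟨ Pr-run-step-centerIs k U ∣U∣≡ j≢j′ ⟩
    firstRound U w j j′ + ∑[ c < n ] when (lookup U c) (w * Pr (run E k (remaining U c)) (centerIs j j′))
      ≡⟨ cong₂ _+_ (firstRound-sym U w j≢j′) (sum-cong-≗ later-sym) ⟩
    firstRound U w j′ j + ∑[ c < n ] when (lookup U c) (w * Pr (run E k (remaining U c)) (centerIs j′ j))
      ≡⟨ Pr-run-step-centerIs k U ∣U∣≡ (j≢j′ ∘ sym) ⟨
    Pr (run E (suc k) U) (centerIs j′ j)
      ∎
    where
    w = unif (suc r)
    later-sym : ∀ c → when (lookup U c) (w * Pr (run E k (remaining U c)) (centerIs j j′))
                      ≡ when (lookup U c) (w * Pr (run E k (remaining U c)) (centerIs j′ j))
    later-sym c = cong (λ z → when (lookup U c) (w * z)) (Pr-run-symmetric k (remaining U c) j≢j′)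

lemma9 : (m n : ℕ) (E : BipGraph m n) (j j' : Fin n) → j ≢ j' →
    PrCenter E j j' ≡ PrCenter E j' j
lemma9 m n E j j' j≢j' = Pr-run-symmetric E n ⊤ j≢j'
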